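{- Let $V$ be a finite set, $\mathcal{R}$ a dense set of betweenness triplets on $V$, and $\mathcal{C}$ a conflict packing of $(V,\mathcal{R})$. Then there exists a linear ordering $\sigma$ of $V$ such that every triplet $t\in\mathcal{R}$ inconsistent with $\sigma$ satisfies $V(t)\subseteq V(\mathcal{C})$.
   Context: A betweenness triplet on $\{a,b,c\}$ chooses one of its elements ($abc$ chooses $b$); $\mathcal{R}$ is dense if it contains exactly one triplet on each 3-subset of $V$. A triplet $abc$ is consistent with a linear ordering $\sigma$ if $b$ lies between $a$ and $c$. A conflict is a 4-set $C\subseteq V$ such that no linear ordering of $C$ is consistent with all triplets of $\mathcal{R}[C]=\{t\in\mathcal{R}:V(t)\subseteq C\}$. A vertex $a$ of a conflict $\{a,b,c,d\}$ is a seed if $\{a,b,c,d\}$ remains a conflict whichever of the three betweenness triplets on $\{b,c,d\}$ is used in place of the one in $\mathcal{R}$. A conflict packing is a sequence of conflicts $C_1,\dots,C_l$ such that for each $2\le i\le l$, either $|C_i\cap\bigcup_{j<i}C_j|\le 2$, or $C_i$ has exactly one vertex not in $\bigcup_{j<i}C_j$ and that vertex is a seed of $C_i$; and which is maximal, i.e. cannot be extended by appending a further conflict satisfying this condition. $V(\mathcal{C})=\bigcup_iC_i$. -}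

module Defs where

open import Data.Nat using (ℕ; _≤_)
import Data.Nat as ℕ
open import Data.Fin using (Fin; toℕ)
open import Data.Fin.Subset using (Subset; _∈_; _∉_; _∩_; _∪_; ∣_∣; ⊥; ⋃)
open import Data.Fin.Permutation using (Permutation′; _⟨$⟩ʳ_)
open import Data.List using (List; []; _∷_)
open import Data.Product using (Σ; _×_; ∃)
open import Data.Sum using (_⊎_)
open import Data.Unit using (⊤)
open import Relation.Nullary using (¬_)
open import Relation.Binary.PropositionalEquality using (_≡_; _≢_)

-- A set of betweenness triplets is given by a relation Mid : V → V → V → Set,
-- where  Mid a b c  means the triplet abc (choosing b, on {a,b,c}) is in R.
-- The triplets abc and cba are the same triplet, so Mid must be symmetric.
Triplets : ℕ → Set₁
Triplets n = Fin n → Fin n → Fin n → Set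

Distinct3 : ∀ {n} → Fin n → Fin n → Fin n → Set
Distinct3 a b c = a ≢ b × b ≢ c × a ≢ c

record Dense {n} (R : Triplets n) : Set where
  field
    distinct  : ∀ {a b c} → R a b c → Distinct3 a b c
    reverse   : ∀ {a b c} → R a b c → R c b a
    some      : ∀ a b c → Distinct3 a b c → R a b c ⊎ R b a c ⊎ R a c b
    unique₁   : ∀ {a b c} → R a b c → ¬ R b a c
    unique₂   : ∀ {a b c} → R a b c → ¬ R a c b

Between : ∀ {n} → (Fin n → ℕ) → Fin n → Fin n → Fin n → Set
Between f a b c = (f a ℕ.< f b × f b ℕ.< f c) ⊎ (f c ℕ.< f b × f b ℕ.< f a)

LinOrderOn : ∀ {n} → Subset n → (Fin n → ℕ) → Set
LinOrderOn C f = ∀ {x y} → x ∈ C → y ∈ C → f x ≡ f y → x ≡ y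

ConsistentOn : ∀ {n} → Triplets n → Subset n → (Fin n → ℕ) → Set
ConsistentOn R C f = ∀ {a b c} → a ∈ C → b ∈ C → c ∈ C → R a b c → Between f a b c

Conflict : ∀ {n} → Triplets n → Subset n → Set
Conflict R C = ∣ C ∣ ≡ 4 × (∀ f → LinOrderOn C f → ¬ ConsistentOn R C f)

-- Replace the triplet on C ∖ {a} by the one choosing m as middle.
Replace : ∀ {n} → Triplets n → Subset n → Fin n → Fin n → Triplets n
Replace R C a m x y z =
  ((x ∈ C × x ≢ a) × (y ∈ C × y ≢ a) × (z ∈ C × z ≢ a) × Distinct3 x y z × y ≡ m)
  ⊎ (¬ ((x ∈ C × x ≢ a) × (y ∈ C × y ≢ a) × (z ∈ C × z ≢ a)) × R x y z)

Seed : ∀ {n} → Triplets n → Subset n → Fin n → Set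
Seed R C a = a ∈ C × Conflict R C
           × (∀ m → m ∈ C → m ≢ a → Conflict (Replace R C a m) C)

CanAppend : ∀ {n} → Triplets n → Subset n → Subset n → Set
CanAppend R U C = Conflict R C ×
  (∣ C ∩ U ∣ ≤ 2
   ⊎ Σ (Fin _) (λ v → v ∈ C × v ∉ U × (∀ w → w ∈ C → w ∉ U → w ≡ v) × Seed R C v))

ValidSeq : ∀ {n} → Triplets n → Subset n → List (Subset n) → Set
ValidSeq R U [] = ⊤
ValidSeq R U (C ∷ Cs) = CanAppend R U C × ValidSeq R (U ∪ C) Cs

VC : ∀ {n} → List (Subset n) → Subset n
VC = ⋃

ConflictPacking : ∀ {n} → Triplets n → List (Subset n) → Set
ConflictPacking R Cs = ValidSeq R ⊥ Cs × (∀ C → ¬ CanAppend R (VC Cs) C)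

pos : ∀ {n} → Permutation′ n → Fin n → ℕ
pos σ x = toℕ (σ ⟨$⟩ʳ x)

-- Let U = V(𝒞) and pick p ∉ U. By maximality no 4-set {p,a,b,c} can be appended
-- to 𝒞. If another of its vertices lies outside U, it meets U in at most two
-- vertices, so it is not a conflict: R[{p,a,b,c}] is realizable. Otherwise p is
-- its only new vertex and is not a seed, so at least the triplets through p in
-- {p,a,b,c} are realizable. Hence the triplets through p behave like betweenness
-- around a point of a line: fixing q ≠ p, the other vertices split into those
-- separated from q by p and the rest, and each side is ordered by distance from p.
-- This order agrees, up to reversal, with every realization of a 4-set containing
-- p, so it is consistent with every triplet through p or with a vertex outside U.
module Submission where

open import Level using (Level; 0ℓ)
open import Data.Nat using (ℕ; suc; _+_; _<_; _≤_; s≤s; s≤s⁻¹)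
open import Data.Nat.Properties using (1+n≰n; <⇒≢; ≤-trans; ≤-<-trans; <-isStrictTotalOrder; <-cmp)
open import Data.Fin using (Fin; zero; suc; toℕ; fromℕ<; punchOut)
open import Data.Fin.Properties using (any?; toℕ-fromℕ<; punchOut-injective; injective⇒≤; _≟_)
open import Data.Fin.Subset using (Subset; _∈_; _∉_; _⊆_; _∪_; _∩_; _-_; ⁅_⁆; ∣_∣; inside; outside)
open import Data.Fin.Subset.Properties
  using (_∈?_; ∈⊤; ∣⊤∣≡n; p⊂q⇒∣p∣<∣q∣; x∈⁅x⁆; x∈⁅y⁆⇒x≡y; x≢y⇒x∉⁅y⁆; ∣⁅x⁆∣≡1; x∈p∪q⁺; x∈p∪q⁻; x∈p∩q⁻;
         ∪-identityˡ; p⊆q⇒∣p∣≤∣q∣; x∈p∧x≢y⇒x∈p-y; x∈p⇒∣p-x∣<∣p∣)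
open import Data.Fin.Permutation using (Permutation′; _⟨$⟩ʳ_; permutation)
import Data.Fin.Permutation as Permutation
open import Data.Vec using (_∷_; here; there; tabulate)
open import Data.Vec.Properties using (lookup∘tabulate; lookup⇒[]=; []=⇒lookup)
open import Data.List using (List)
open import Data.Product using (Σ; ∃; _×_; _,_; proj₁; proj₂)
open import Data.Sum using (_⊎_; inj₁; inj₂; [_,_]; swap; assocˡ; assocʳ; map₁; map₂)
open import Function using (_∘_; flip)
open import Function.Definitions using (Injective)
open import Relation.Nullary using (¬_; Dec; yes; no; does; contradiction)
open import Relation.Nullary.Negation using (¬¬-map; negated-stable)
open import Relation.Nullary.Decidable using (dec-true; decidable-stable; ¬?; _×-dec_; _⊎-dec_)
open import Relation.Binary
  using (Rel; IsStrictTotalOrder; Irreflexive; Transitive; Trichotomous; Tri; tri<; tri≈; tri>)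
import Relation.Binary.Construct.Flip.EqAndOrd as Flip
open import Relation.Binary.PropositionalEquality
  using (_≡_; _≢_; ≢-sym; refl; sym; trans; cong; subst; subst₂; resp₂; isEquivalence; module ≡-Reasoning)
open import Defs

private variable a b ℓ ℓ′ : Level

-- Permutations realizing strict total orders on Fin n

injective⇒surjective : ∀ {n} {f : Fin n → Fin n} → Injective _≡_ _≡_ f → ∀ y → ∃ λ x → f x ≡ y
injective⇒surjective {suc k} {f} f-inj y with any? (λ x → f x ≟ y)
... | yes hit = hit
... | no miss = contradiction (injective⇒≤ punched-injective) 1+n≰n
  where
  y≢f : ∀ x → y ≢ f x
  y≢f x y≡fx = miss (x , sym y≡fx)
  punched : Fin (suc k) → Fin k
  punched x = punchOut (y≢f x)
  punched-injective : Injective _≡_ _≡_ punched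
  punched-injective eq = f-inj (punchOut-injective (y≢f _) (y≢f _) eq)

injective⇒permutation : ∀ {n} (f : Fin n → Fin n) → Injective _≡_ _≡_ f →
  Σ (Permutation′ n) λ σ → ∀ x → σ ⟨$⟩ʳ x ≡ f x
injective⇒permutation {n} f f-inj =
  permutation f f⁻¹ (λ y → proj₂ (surjective y)) (λ x → f-inj (proj₂ (surjective (f x)))) , λ _ → refl
  where
  surjective : ∀ y → ∃ λ x → f x ≡ y
  surjective = injective⇒surjective f-inj
  f⁻¹ : Fin n → Fin n
  f⁻¹ y = proj₁ (surjective y)

module StrictTotalOrderRank {n} {_≺_ : Rel (Fin n) ℓ} (sto : IsStrictTotalOrder _≡_ _≺_) where
  open IsStrictTotalOrder sto using (compare; _<?_) renaming (trans to ≺-trans; irrefl to ≺-irrefl)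

  predecessors : Fin n → Subset n
  predecessors x = tabulate (λ y → does (y <? x))

  ∈-predecessors⁺ : ∀ {x y} → y ≺ x → y ∈ predecessors x
  ∈-predecessors⁺ {x} {y} y≺x = lookup⇒[]= y _ (trans (lookup∘tabulate _ y) (dec-true (y <? x) y≺x))

  ∈-predecessors⁻ : ∀ {x y} → y ∈ predecessors x → y ≺ x
  ∈-predecessors⁻ {x} {y} y∈ with y <? x | trans (sym (lookup∘tabulate (λ z → does (z <? x)) y)) ([]=⇒lookup y∈)
  ... | yes y≺x | _  = y≺x
  ... | no _    | ()

  rank : Fin n → ℕ
  rank x = ∣ predecessors x ∣

  rank-mono : ∀ {x y} → x ≺ y → rank x < rank y
  rank-mono {x} x≺y = p⊂q⇒∣p∣<∣q∣
    ( (λ z∈ → ∈-predecessors⁺ (≺-trans (∈-predecessors⁻ z∈) x≺y))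
    , x , ∈-predecessors⁺ x≺y , ≺-irrefl refl ∘ ∈-predecessors⁻)

  rank<n : ∀ x → rank x < n
  rank<n x = subst (rank x <_) (∣⊤∣≡n n)
    (p⊂q⇒∣p∣<∣q∣ ((λ _ → ∈⊤) , x , ∈⊤ , ≺-irrefl refl ∘ ∈-predecessors⁻))

  rank-injective : ∀ {x y} → rank x ≡ rank y → x ≡ y
  rank-injective {x} {y} eq with compare x y
  ... | tri< x≺y _ _ = contradiction eq (<⇒≢ (rank-mono x≺y))
  ... | tri≈ _ x≡y _ = x≡y
  ... | tri> _ _ y≺x = contradiction (sym eq) (<⇒≢ (rank-mono y≺x))

strictTotalOrder⇒permutation : ∀ {n} {_≺_ : Rel (Fin n) ℓ} → IsStrictTotalOrder _≡_ _≺_ →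
  Σ (Permutation′ n) λ σ → ∀ {x y} → x ≺ y → pos σ x < pos σ y
strictTotalOrder⇒permutation {n = n} sto = σ , λ x≺y → subst₂ _<_ (rank≡pos _) (rank≡pos _) (rank-mono x≺y)
  where
  open StrictTotalOrderRank sto
  rankFin : Fin n → Fin n
  rankFin x = fromℕ< (rank<n x)
  toℕ-rankFin : ∀ x → toℕ (rankFin x) ≡ rank x
  toℕ-rankFin x = toℕ-fromℕ< (rank<n x)
  rankFin-injective : Injective _≡_ _≡_ rankFin
  rankFin-injective {x} {y} eq = rank-injective (begin
    rank x             ≡⟨ sym (toℕ-rankFin x) ⟩
    toℕ (rankFin x)    ≡⟨ cong toℕ eq ⟩
    toℕ (rankFin y)    ≡⟨ toℕ-rankFin y ⟩
    rank y             ∎)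
    where open ≡-Reasoning
  ranking : Σ (Permutation′ n) λ σ → ∀ x → σ ⟨$⟩ʳ x ≡ rankFin x
  ranking = injective⇒permutation rankFin rankFin-injective
  σ : Permutation′ n
  σ = proj₁ ranking
  rank≡pos : ∀ x → rank x ≡ pos σ x
  rank≡pos x = sym (trans (cong toℕ (proj₂ ranking x)) (toℕ-rankFin x))

-- Betweenness with respect to a strict total order

Btw : {A : Set a} → Rel A ℓ → A → A → A → Set ℓ
Btw _⊏_ u v w = (u ⊏ v × v ⊏ w) ⊎ (w ⊏ v × v ⊏ u)

module BtwProperties {A : Set a} (_⊏_ : Rel A ℓ) where

  Btw-sym : ∀ {u v w} → Btw _⊏_ u v w → Btw _⊏_ w v u
  Btw-sym (inj₁ (u⊏v , v⊏w)) = inj₂ (u⊏v , v⊏w)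
  Btw-sym (inj₂ (w⊏v , v⊏u)) = inj₁ (w⊏v , v⊏u)

  Btw-flip : ∀ {u v w} → Btw _⊏_ u v w → Btw (flip _⊏_) u v w
  Btw-flip (inj₁ (u⊏v , v⊏w)) = inj₂ (v⊏w , u⊏v)
  Btw-flip (inj₂ (w⊏v , v⊏u)) = inj₁ (v⊏u , w⊏v)

  Btw-map : ∀ {B : Set b} {_<_ : Rel B ℓ′} (g : A → B) → (∀ {x y} → x ⊏ y → g x < g y) →
            ∀ {u v w} → Btw _⊏_ u v w → Btw _<_ (g u) (g v) (g w)
  Btw-map g mono (inj₁ (u⊏v , v⊏w)) = inj₁ (mono u⊏v , mono v⊏w)
  Btw-map g mono (inj₂ (w⊏v , v⊏u)) = inj₂ (mono w⊏v , mono v⊏u)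

  Btw? : (∀ x y → Dec (x ⊏ y)) → ∀ u v w → Dec (Btw _⊏_ u v w)
  Btw? _⊏?_ u v w = (u ⊏? v ×-dec v ⊏? w) ⊎-dec (w ⊏? v ×-dec v ⊏? u)

module StrictTotalOrderBetweenness {A : Set a} {_⊏_ : Rel A ℓ} (sto : IsStrictTotalOrder _≡_ _⊏_) where
  open IsStrictTotalOrder sto using (compare; asym) renaming (trans to ⊏-trans)
  open BtwProperties _⊏_

  private
    B : A → A → A → Set ℓ
    B = Btw _⊏_

  Btw-unique₁ : ∀ {u v w} → B u v w → ¬ B v u w
  Btw-unique₁ (inj₁ (u⊏v , _))   (inj₁ (v⊏u , _)) = asym u⊏v v⊏u
  Btw-unique₁ (inj₁ (u⊏v , v⊏w)) (inj₂ (w⊏u , _)) = asym (⊏-trans u⊏v v⊏w) w⊏u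
  Btw-unique₁ (inj₂ (w⊏v , v⊏u)) (inj₁ (_ , u⊏w)) = asym (⊏-trans w⊏v v⊏u) u⊏w
  Btw-unique₁ (inj₂ (_ , v⊏u))   (inj₂ (_ , u⊏v)) = asym v⊏u u⊏v

  Btw-unique₂ : ∀ {u v w} → B u v w → ¬ B u w v
  Btw-unique₂ uvw uwv = Btw-unique₁ (Btw-sym uvw) (Btw-sym uwv)

  Btw-trans : ∀ {p u v w} → B p u v → B p v w → B p u w
  Btw-trans (inj₁ (p⊏u , u⊏v)) (inj₁ (_ , v⊏w)) = inj₁ (p⊏u , ⊏-trans u⊏v v⊏w)
  Btw-trans (inj₁ (p⊏u , u⊏v)) (inj₂ (_ , v⊏p)) = contradiction (⊏-trans p⊏u u⊏v) (asym v⊏p)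
  Btw-trans (inj₂ (v⊏u , u⊏p)) (inj₁ (p⊏v , _)) = contradiction (⊏-trans v⊏u u⊏p) (asym p⊏v)
  Btw-trans (inj₂ (v⊏u , u⊏p)) (inj₂ (w⊏v , _)) = inj₂ (⊏-trans w⊏v v⊏u , u⊏p)

  module _ {p : A} where

    Btw-pivot-below : ∀ {u v} → B u p v → u ⊏ p → p ⊏ v
    Btw-pivot-below (inj₁ (_ , p⊏v)) _   = p⊏v
    Btw-pivot-below (inj₂ (_ , p⊏u)) u⊏p = contradiction u⊏p (asym p⊏u)

    Btw-pivot-above : ∀ {u v} → B u p v → p ⊏ u → v ⊏ p
    Btw-pivot-above (inj₁ (u⊏p , _)) p⊏u = contradiction u⊏p (asym p⊏u)
    Btw-pivot-above (inj₂ (v⊏p , _)) _   = v⊏p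

    ¬Btw-pivot-below : ∀ {u v} → ¬ B u p v → v ≢ p → u ⊏ p → v ⊏ p
    ¬Btw-pivot-below {v = v} ¬uPv v≢p u⊏p with compare v p
    ... | tri< v⊏p _ _ = v⊏p
    ... | tri≈ _ v≡p _ = contradiction v≡p v≢p
    ... | tri> _ _ p⊏v = contradiction (inj₁ (u⊏p , p⊏v)) ¬uPv

    ¬Btw-pivot-above : ∀ {u v} → ¬ B u p v → v ≢ p → p ⊏ u → p ⊏ v
    ¬Btw-pivot-above {v = v} ¬uPv v≢p p⊏u with compare v p
    ... | tri< v⊏p _ _ = contradiction (inj₂ (v⊏p , p⊏u)) ¬uPv
    ... | tri≈ _ v≡p _ = contradiction v≡p v≢p
    ... | tri> _ _ p⊏v = p⊏v

    Btw-pivot-opp-opp : ∀ {u v w} → B u p w → B v p w → ¬ B u p v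
    Btw-pivot-opp-opp (inj₁ (u⊏p , p⊏w)) vPw uPv =
      asym (Btw-pivot-below uPv u⊏p) (Btw-pivot-above (Btw-sym vPw) p⊏w)
    Btw-pivot-opp-opp (inj₂ (w⊏p , p⊏u)) vPw uPv =
      asym (Btw-pivot-below (Btw-sym vPw) w⊏p) (Btw-pivot-above uPv p⊏u)

    Btw-pivot-same-same : ∀ {u v w} → w ≢ p → ¬ B u p w → ¬ B v p w → ¬ B u p v
    Btw-pivot-same-same w≢p ¬uPw ¬vPw (inj₁ (u⊏p , p⊏v)) =
      asym (¬Btw-pivot-below ¬uPw w≢p u⊏p) (¬Btw-pivot-above ¬vPw w≢p p⊏v)
    Btw-pivot-same-same w≢p ¬uPw ¬vPw (inj₂ (v⊏p , p⊏u)) =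
      asym (¬Btw-pivot-below ¬vPw w≢p v⊏p) (¬Btw-pivot-above ¬uPw w≢p p⊏u)

    Btw-pivot-opp-same : ∀ {u v w} → v ≢ p → B u p w → ¬ B v p w → B u p v
    Btw-pivot-opp-same v≢p (inj₁ (u⊏p , p⊏w)) ¬vPw =
      inj₁ (u⊏p , ¬Btw-pivot-above (¬vPw ∘ Btw-sym) v≢p p⊏w)
    Btw-pivot-opp-same v≢p (inj₂ (w⊏p , p⊏u)) ¬vPw =
      inj₂ (¬Btw-pivot-below (¬vPw ∘ Btw-sym) v≢p w⊏p , p⊏u)

∣⁅x⁆∪p∣≡1+∣p∣ : ∀ {n} {x : Fin n} {p : Subset n} → x ∉ p → ∣ ⁅ x ⁆ ∪ p ∣ ≡ suc ∣ p ∣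
∣⁅x⁆∪p∣≡1+∣p∣ {x = zero}  {outside ∷ p} _   = cong (suc ∘ ∣_∣) (∪-identityˡ p)
∣⁅x⁆∪p∣≡1+∣p∣ {x = zero}  {inside ∷ p}  x∉p = contradiction here x∉p
∣⁅x⁆∪p∣≡1+∣p∣ {x = suc x} {outside ∷ p} x∉p = ∣⁅x⁆∪p∣≡1+∣p∣ (x∉p ∘ there)
∣⁅x⁆∪p∣≡1+∣p∣ {x = suc x} {inside ∷ p}  x∉p = cong suc (∣⁅x⁆∪p∣≡1+∣p∣ (x∉p ∘ there))

∉-∪ : ∀ {n} {x : Fin n} {p q : Subset n} → x ∉ p → x ∉ q → x ∉ p ∪ q
∉-∪ {p = p} {q} x∉p x∉q = [ x∉p , x∉q ] ∘ x∈p∪q⁻ p q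

2+∣p∩q∣≤∣p∣ : ∀ {n} {p q : Subset n} {u w} → u ∈ p → w ∈ p → u ≢ w → u ∉ q → w ∉ q →
  2 + ∣ p ∩ q ∣ ≤ ∣ p ∣
2+∣p∩q∣≤∣p∣ {p = p} {q} {u} {w} u∈p w∈p u≢w u∉q w∉q =
  ≤-trans (s≤s (≤-<-trans (p⊆q⇒∣p∣≤∣q∣ p∩q⊆p-u-w) (x∈p⇒∣p-x∣<∣p∣ w∈p-u))) (x∈p⇒∣p-x∣<∣p∣ u∈p)
  where
  w∈p-u : w ∈ p - u
  w∈p-u = x∈p∧x≢y⇒x∈p-y w∈p (u≢w ∘ sym)
  p∩q⊆p-u-w : p ∩ q ⊆ p - u - w
  p∩q⊆p-u-w x∈p∩q with x∈p∩q⁻ p q x∈p∩q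
  ... | x∈p , x∈q = x∈p∧x≢y⇒x∈p-y (x∈p∧x≢y⇒x∈p-y x∈p λ { refl → u∉q x∈q }) λ { refl → w∉q x∈q }

Distinct₄ : ∀ {n} → Fin n → Fin n → Fin n → Fin n → Set
Distinct₄ p a b c = p ≢ a × p ≢ b × p ≢ c × Distinct3 a b c

fourSet : ∀ {n} → Fin n → Fin n → Fin n → Fin n → Subset n
fourSet p a b c = ⁅ p ⁆ ∪ ⁅ a ⁆ ∪ ⁅ b ⁆ ∪ ⁅ c ⁆

module _ {n} {p a b c : Fin n} where

  ∈-fourSet₁ : p ∈ fourSet p a b c
  ∈-fourSet₁ = x∈p∪q⁺ (inj₁ (x∈⁅x⁆ p))

  ∈-fourSet₂ : a ∈ fourSet p a b c
  ∈-fourSet₂ = x∈p∪q⁺ (inj₂ (x∈p∪q⁺ (inj₁ (x∈⁅x⁆ a))))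

  ∈-fourSet₃ : b ∈ fourSet p a b c
  ∈-fourSet₃ = x∈p∪q⁺ (inj₂ (x∈p∪q⁺ (inj₂ (x∈p∪q⁺ (inj₁ (x∈⁅x⁆ b))))))

  ∈-fourSet₄ : c ∈ fourSet p a b c
  ∈-fourSet₄ = x∈p∪q⁺ (inj₂ (x∈p∪q⁺ (inj₂ (x∈p∪q⁺ (inj₂ (x∈⁅x⁆ c))))))

  ∈-fourSet⁻ : ∀ {x} → x ∈ fourSet p a b c → x ≡ p ⊎ x ≡ a ⊎ x ≡ b ⊎ x ≡ c
  ∈-fourSet⁻ x∈ with x∈p∪q⁻ ⁅ p ⁆ _ x∈
  ... | inj₁ x∈p = inj₁ (x∈⁅y⁆⇒x≡y p x∈p)
  ... | inj₂ x∈abc with x∈p∪q⁻ ⁅ a ⁆ _ x∈abc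
  ...   | inj₁ x∈a = inj₂ (inj₁ (x∈⁅y⁆⇒x≡y a x∈a))
  ...   | inj₂ x∈bc with x∈p∪q⁻ ⁅ b ⁆ _ x∈bc
  ...     | inj₁ x∈b = inj₂ (inj₂ (inj₁ (x∈⁅y⁆⇒x≡y b x∈b)))
  ...     | inj₂ x∈c = inj₂ (inj₂ (inj₂ (x∈⁅y⁆⇒x≡y c x∈c)))

  ∣fourSet∣≡4 : Distinct₄ p a b c → ∣ fourSet p a b c ∣ ≡ 4
  ∣fourSet∣≡4 (p≢a , p≢b , p≢c , a≢b , b≢c , a≢c) = begin
    ∣ ⁅ p ⁆ ∪ ⁅ a ⁆ ∪ ⁅ b ⁆ ∪ ⁅ c ⁆ ∣
      ≡⟨ ∣⁅x⁆∪p∣≡1+∣p∣ (∉-∪ (x≢y⇒x∉⁅y⁆ p≢a) (∉-∪ (x≢y⇒x∉⁅y⁆ p≢b) (x≢y⇒x∉⁅y⁆ p≢c))) ⟩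
    1 + ∣ ⁅ a ⁆ ∪ ⁅ b ⁆ ∪ ⁅ c ⁆ ∣
      ≡⟨ cong (1 +_) (∣⁅x⁆∪p∣≡1+∣p∣ (∉-∪ (x≢y⇒x∉⁅y⁆ a≢b) (x≢y⇒x∉⁅y⁆ a≢c))) ⟩
    2 + ∣ ⁅ b ⁆ ∪ ⁅ c ⁆ ∣
      ≡⟨ cong (2 +_) (∣⁅x⁆∪p∣≡1+∣p∣ (x≢y⇒x∉⁅y⁆ b≢c)) ⟩
    3 + ∣ ⁅ c ⁆ ∣
      ≡⟨ cong (3 +_) (∣⁅x⁆∣≡1 c) ⟩
    4 ∎
    where open ≡-Reasoning

-- Realizations, conflicts and seeds

Through : ∀ {n} → Fin n → Fin n → Fin n → Fin n → Set
Through p x y z = x ≡ p ⊎ y ≡ p ⊎ z ≡ p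

Link : ∀ {n} → Triplets n → Fin n → Triplets n
Link R p x y z = R x y z × Through p x y z

-- Positions are compared by an arbitrary order _⊏_, so that a realization
-- (_⊏_ = _<_) and its mirror image (flip _<_) are handled alike.
Model : ∀ {n} → Rel ℕ 0ℓ → Triplets n → Subset n → (Fin n → ℕ) → Set
Model _⊏_ R C f = LinOrderOn C f ×
  (∀ {a b c} → a ∈ C → b ∈ C → c ∈ C → R a b c → Btw _⊏_ (f a) (f b) (f c))

Realizable : ∀ {n} → Triplets n → Subset n → Set
Realizable {n} R C = Σ (Fin n → ℕ) (Model _<_ R C)

Model-flip : ∀ {n} {_⊏_ : Rel ℕ 0ℓ} {R : Triplets n} {C f} → Model _⊏_ R C f → Model (flip _⊏_) R C f
Model-flip {_⊏_ = _⊏_} (injective , consistent) =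
  injective , λ a∈ b∈ c∈ r → BtwProperties.Btw-flip _⊏_ (consistent a∈ b∈ c∈ r)

module _ {n} {C : Subset n} where

  unrealizable⇒conflict : ∀ {R} → ∣ C ∣ ≡ 4 → ¬ Realizable R C → Conflict R C
  unrealizable⇒conflict ∣C∣≡4 ¬real = ∣C∣≡4 , λ f injective consistent → ¬real (f , injective , consistent)

  Conflict-⊇ : ∀ {R R′ : Triplets n} → (∀ {a b c} → R a b c → R′ a b c) → Conflict R C → Conflict R′ C
  Conflict-⊇ R⊆R′ (∣C∣≡4 , none) =
    ∣C∣≡4 , λ f injective consistent → none f injective λ a∈ b∈ c∈ r → consistent a∈ b∈ c∈ (R⊆R′ r)

  Link⊆Replace : ∀ {R p m a b c} → Link R p a b c → Replace R C p m a b c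
  Link⊆Replace (r , through) =
    inj₂ ((λ ((_ , a≢p) , (_ , b≢p) , (_ , c≢p)) → [ a≢p , [ b≢p , c≢p ] ] through) , r)

  unrealizable-link⇒seed : ∀ {R p} → p ∈ C → ∣ C ∣ ≡ 4 → ¬ Realizable (Link R p) C → Seed R C p
  unrealizable-link⇒seed {R} {p} p∈C ∣C∣≡4 ¬real =
    p∈C , Conflict-⊇ proj₁ conflict , λ m _ _ → Conflict-⊇ (Link⊆Replace {R}) conflict
    where
    conflict : Conflict (Link R p) C
    conflict = unrealizable⇒conflict ∣C∣≡4 ¬real

module DenseProperties {n} {R : Triplets n} (D : Dense R) where
  open Dense D

  distinct₁₂ : ∀ {a b c} → R a b c → a ≢ b
  distinct₁₂ = proj₁ ∘ distinct

  distinct₂₃ : ∀ {a b c} → R a b c → b ≢ c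
  distinct₂₃ = proj₁ ∘ proj₂ ∘ distinct

  distinct₁₃ : ∀ {a b c} → R a b c → a ≢ c
  distinct₁₃ = proj₂ ∘ proj₂ ∘ distinct

  R? : ∀ a b c → Dec (R a b c)
  R? a b c with a ≟ b | b ≟ c | a ≟ c
  ... | yes a≡b | _       | _       = no λ r → distinct₁₂ r a≡b
  ... | no _    | yes b≡c | _       = no λ r → distinct₂₃ r b≡c
  ... | no _    | no _    | yes a≡c = no λ r → distinct₁₃ r a≡c
  ... | no a≢b  | no b≢c  | no a≢c with some a b c (a≢b , b≢c , a≢c)
  ...   | inj₁ r          = yes r
  ...   | inj₂ (inj₁ bac) = no λ r → unique₁ r bac
  ...   | inj₂ (inj₂ acb) = no λ r → unique₂ r acb

  module LinkModel {_⊏_ : Rel ℕ 0ℓ} (sto : IsStrictTotalOrder _≡_ _⊏_) {p : Fin n} {C : Subset n}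
                   {f : Fin n → ℕ} (p∈C : p ∈ C) (model : Model _⊏_ (Link R p) C f) where
    open StrictTotalOrderBetweenness sto

    f-≢ : ∀ {x y} → x ∈ C → y ∈ C → x ≢ y → f x ≢ f y
    f-≢ x∈ y∈ x≢y = x≢y ∘ proj₁ model x∈ y∈

    R⇒Btw : ∀ {x y z} → x ∈ C → y ∈ C → z ∈ C → Through p x y z → R x y z → Btw _⊏_ (f x) (f y) (f z)
    R⇒Btw x∈ y∈ z∈ through r = proj₂ model x∈ y∈ z∈ (r , through)

    Btw⇒R : ∀ {x y z} → x ∈ C → y ∈ C → z ∈ C → Through p x y z → Distinct3 x y z →
            Btw _⊏_ (f x) (f y) (f z) → R x y z
    Btw⇒R x∈ y∈ z∈ through xyz btw with some _ _ _ xyz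
    ... | inj₁ r          = r
    ... | inj₂ (inj₁ yxz) =
      contradiction (R⇒Btw y∈ x∈ z∈ (assocʳ (map₁ swap (assocˡ through))) yxz) (Btw-unique₁ btw)
    ... | inj₂ (inj₂ xzy) = contradiction (R⇒Btw x∈ z∈ y∈ (map₂ swap through) xzy) (Btw-unique₂ btw)

    mid⇒Btw : ∀ {x y} → x ∈ C → y ∈ C → R x p y → Btw _⊏_ (f x) (f p) (f y)
    mid⇒Btw x∈ y∈ = R⇒Btw x∈ p∈C y∈ (inj₂ (inj₁ refl))

    Btw⇒mid : ∀ {x y} → x ∈ C → y ∈ C → Distinct3 x p y → Btw _⊏_ (f x) (f p) (f y) → R x p y
    Btw⇒mid x∈ y∈ = Btw⇒R x∈ p∈C y∈ (inj₂ (inj₁ refl))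

    first⇒Btw : ∀ {x y} → x ∈ C → y ∈ C → R p x y → Btw _⊏_ (f p) (f x) (f y)
    first⇒Btw x∈ y∈ = R⇒Btw p∈C x∈ y∈ (inj₁ refl)

    Btw⇒first : ∀ {x y} → x ∈ C → y ∈ C → Distinct3 p x y → Btw _⊏_ (f p) (f x) (f y) → R p x y
    Btw⇒first x∈ y∈ = Btw⇒R p∈C x∈ y∈ (inj₁ refl)

-- The order around a pivot

-- Realizations are only available under a double negation (maximality refutes
-- their absence), so everything drawn from them below is decidable or negative.
module OrderAroundPivot {n} {R : Triplets n} (D : Dense R) (p q : Fin n) (q≢p : q ≢ p)
  (link-realizable : ∀ {a b c} → Distinct₄ p a b c → ¬ ¬ Realizable (Link R p) (fourSet p a b c)) where
  open Dense D
  open DenseProperties D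
  open StrictTotalOrderBetweenness <-isStrictTotalOrder

  Left : Fin n → Set
  Left x = R x p q

  Right : Fin n → Set
  Right x = x ≢ p × ¬ Left x

  left⇒≢p : ∀ {x} → Left x → x ≢ p
  left⇒≢p = distinct₁₂

  left⇒≢q : ∀ {x} → Left x → x ≢ q
  left⇒≢q = distinct₁₃

  ¬left-pivot : ¬ Left p
  ¬left-pivot lp = left⇒≢p lp refl

  via-link : ∀ {a b c} {B : Set} → Distinct₄ p a b c →
             (∀ {f} → Model _<_ (Link R p) (fourSet p a b c) f → B) → ¬ ¬ B
  via-link d k = ¬¬-map (λ (_ , model) → k model) (link-realizable d)

  left-left⇒¬mid : ∀ {x y} → Left x → Left y → ¬ R x p y
  left-left⇒¬mid {x} {y} lx ly with x ≟ y
  ... | yes refl = λ r → distinct₁₃ r refl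
  ... | no x≢y   = negated-stable (via-link d fact)
    where
    d : Distinct₄ p x y q
    d = ≢-sym (left⇒≢p lx) , ≢-sym (left⇒≢p ly) , ≢-sym q≢p , x≢y , left⇒≢q ly , left⇒≢q lx
    fact : ∀ {f} → Model _<_ (Link R p) (fourSet p x y q) f → ¬ R x p y
    fact m r = Btw-pivot-opp-opp (mid⇒Btw ∈-fourSet₂ ∈-fourSet₄ lx) (mid⇒Btw ∈-fourSet₃ ∈-fourSet₄ ly)
                                 (mid⇒Btw ∈-fourSet₂ ∈-fourSet₃ r)
      where open LinkModel <-isStrictTotalOrder ∈-fourSet₁ m

  right-right⇒¬mid : ∀ {x y} → Right x → Right y → ¬ R x p y
  right-right⇒¬mid {x} {y} (x≢p , ¬lx) (y≢p , ¬ly) with x ≟ q | y ≟ q | x ≟ y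
  ... | yes refl | _        | _        = ¬ly ∘ reverse
  ... | no _     | yes refl | _        = ¬lx
  ... | no _     | no _     | yes refl = λ r → distinct₁₃ r refl
  ... | no x≢q   | no y≢q   | no x≢y   = negated-stable (via-link d fact)
    where
    d : Distinct₄ p x y q
    d = ≢-sym x≢p , ≢-sym y≢p , ≢-sym q≢p , x≢y , y≢q , x≢q
    fact : ∀ {f} → Model _<_ (Link R p) (fourSet p x y q) f → ¬ R x p y
    fact m r = Btw-pivot-same-same (f-≢ ∈-fourSet₄ ∈-fourSet₁ q≢p)
      (¬lx ∘ Btw⇒mid ∈-fourSet₂ ∈-fourSet₄ (x≢p , ≢-sym q≢p , x≢q))
      (¬ly ∘ Btw⇒mid ∈-fourSet₃ ∈-fourSet₄ (y≢p , ≢-sym q≢p , y≢q))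
      (mid⇒Btw ∈-fourSet₂ ∈-fourSet₃ r)
      where open LinkModel <-isStrictTotalOrder ∈-fourSet₁ m

  left-right⇒mid : ∀ {x y} → Left x → Right y → R x p y
  left-right⇒mid {x} {y} lx (y≢p , ¬ly) with y ≟ q | x ≟ y
  ... | yes refl | _        = lx
  ... | no _     | yes refl = contradiction lx ¬ly
  ... | no y≢q   | no x≢y   = decidable-stable (R? x p y) (via-link d fact)
    where
    d : Distinct₄ p x y q
    d = ≢-sym (left⇒≢p lx) , ≢-sym y≢p , ≢-sym q≢p , x≢y , y≢q , left⇒≢q lx
    fact : ∀ {f} → Model _<_ (Link R p) (fourSet p x y q) f → R x p y
    fact m = Btw⇒mid ∈-fourSet₂ ∈-fourSet₃ (left⇒≢p lx , ≢-sym y≢p , x≢y)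
      (Btw-pivot-opp-same (f-≢ ∈-fourSet₃ ∈-fourSet₁ y≢p) (mid⇒Btw ∈-fourSet₂ ∈-fourSet₄ lx)
        (¬ly ∘ Btw⇒mid ∈-fourSet₃ ∈-fourSet₄ (y≢p , ≢-sym q≢p , y≢q)))
      where open LinkModel <-isStrictTotalOrder ∈-fourSet₁ m

  first-trans : ∀ {x y z} → R p x y → R p y z → R p x z
  first-trans {x} {y} {z} pxy pyz with x ≟ z
  ... | yes refl = contradiction pyz (unique₂ pxy)
  ... | no x≢z   = decidable-stable (R? p x z) (via-link d fact)
    where
    d : Distinct₄ p x y z
    d = distinct₁₂ pxy , distinct₁₃ pxy , distinct₁₃ pyz , distinct₂₃ pxy , distinct₂₃ pyz , x≢z
    fact : ∀ {f} → Model _<_ (Link R p) (fourSet p x y z) f → R p x z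
    fact m = Btw⇒first ∈-fourSet₂ ∈-fourSet₄ (distinct₁₂ pxy , x≢z , distinct₁₃ pyz)
      (Btw-trans (first⇒Btw ∈-fourSet₂ ∈-fourSet₃ pxy) (first⇒Btw ∈-fourSet₃ ∈-fourSet₄ pyz))
      where open LinkModel <-isStrictTotalOrder ∈-fourSet₁ m

  ordered-same-side : ∀ {x y} → x ≢ p → y ≢ p → x ≢ y → ¬ R x p y → R p x y ⊎ R p y x
  ordered-same-side x≢p y≢p x≢y ¬xpy with some p _ _ (≢-sym x≢p , x≢y , ≢-sym y≢p)
  ... | inj₁ pxy        = inj₁ pxy
  ... | inj₂ (inj₁ xpy) = contradiction xpy ¬xpy
  ... | inj₂ (inj₂ pyx) = inj₂ pyx

  -- Left vertices by decreasing distance from p, then p, then Right vertices by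
  -- increasing distance from p.
  data _≺_ : Fin n → Fin n → Set where
    left≺pivot  : ∀ {x} → Left x → x ≺ p
    pivot≺right : ∀ {y} → Right y → p ≺ y
    left≺right  : ∀ {x y} → Left x → Right y → x ≺ y
    left≺left   : ∀ {x y} → Left x → Left y → R p y x → x ≺ y
    right≺right : ∀ {x y} → Right x → Right y → R p x y → x ≺ y

  ≺-irrefl : Irreflexive _≡_ _≺_
  ≺-irrefl refl (left≺pivot lp)           = ¬left-pivot lp
  ≺-irrefl refl (pivot≺right (p≢p , _))   = p≢p refl
  ≺-irrefl refl (left≺right lx (_ , ¬lx)) = ¬lx lx
  ≺-irrefl refl (left≺left _ _ r)         = distinct₂₃ r refl
  ≺-irrefl refl (right≺right _ _ r)       = distinct₂₃ r refl

  ≺-trans : Transitive _≺_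
  ≺-trans (left≺pivot lx)              (pivot≺right rz)            = left≺right lx rz
  ≺-trans (left≺pivot _)               (left≺pivot lp)             = contradiction lp ¬left-pivot
  ≺-trans (left≺pivot _)               (left≺right lp _)           = contradiction lp ¬left-pivot
  ≺-trans (left≺pivot _)               (left≺left lp _ _)          = contradiction lp ¬left-pivot
  ≺-trans (left≺pivot _)               (right≺right (p≢p , _) _ _) = contradiction refl p≢p
  ≺-trans (pivot≺right (_ , ¬ly))      (left≺pivot ly)             = contradiction ly ¬ly
  ≺-trans (pivot≺right (y≢p , _))      (pivot≺right _)             = contradiction refl y≢p
  ≺-trans (pivot≺right (_ , ¬ly))      (left≺right ly _)           = contradiction ly ¬ly
  ≺-trans (pivot≺right (_ , ¬ly))      (left≺left ly _ _)          = contradiction ly ¬ly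
  ≺-trans (pivot≺right _)              (right≺right _ rz _)        = pivot≺right rz
  ≺-trans (left≺right _ (_ , ¬ly))     (left≺pivot ly)             = contradiction ly ¬ly
  ≺-trans (left≺right _ (y≢p , _))     (pivot≺right _)             = contradiction refl y≢p
  ≺-trans (left≺right _ (_ , ¬ly))     (left≺right ly _)           = contradiction ly ¬ly
  ≺-trans (left≺right _ (_ , ¬ly))     (left≺left ly _ _)          = contradiction ly ¬ly
  ≺-trans (left≺right lx _)            (right≺right _ rz _)        = left≺right lx rz
  ≺-trans (left≺left lx _ _)           (left≺pivot _)              = left≺pivot lx
  ≺-trans (left≺left _ ly _)           (pivot≺right _)             = contradiction ly ¬left-pivot
  ≺-trans (left≺left lx _ _)           (left≺right _ rz)           = left≺right lx rz
  ≺-trans (left≺left lx _ pyx)         (left≺left _ lz pzy)        = left≺left lx lz (first-trans pzy pyx)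
  ≺-trans (left≺left _ ly _)           (right≺right (_ , ¬ly) _ _) = contradiction ly ¬ly
  ≺-trans (right≺right _ (_ , ¬ly) _)  (left≺pivot ly)             = contradiction ly ¬ly
  ≺-trans (right≺right _ (y≢p , _) _)  (pivot≺right _)             = contradiction refl y≢p
  ≺-trans (right≺right _ (_ , ¬ly) _)  (left≺right ly _)           = contradiction ly ¬ly
  ≺-trans (right≺right _ (_ , ¬ly) _)  (left≺left ly _ _)          = contradiction ly ¬ly
  ≺-trans (right≺right rx _ pxy)       (right≺right _ rz pyz)      = right≺right rx rz (first-trans pxy pyz)

  ≺-asym : ∀ {x y} → x ≺ y → ¬ y ≺ x
  ≺-asym x≺y y≺x = ≺-irrefl refl (≺-trans x≺y y≺x)

  ≺-connex : ∀ {x y} → x ≢ y → x ≺ y ⊎ y ≺ x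
  ≺-connex {x} {y} x≢y with x ≟ p | y ≟ p | R? x p q | R? y p q
  ... | yes refl | yes refl | _      | _      = contradiction refl x≢y
  ... | yes refl | no y≢p   | _      | yes ly = inj₂ (left≺pivot ly)
  ... | yes refl | no y≢p   | _      | no ¬ly = inj₁ (pivot≺right (y≢p , ¬ly))
  ... | no x≢p   | yes refl | yes lx | _      = inj₁ (left≺pivot lx)
  ... | no x≢p   | yes refl | no ¬lx | _      = inj₂ (pivot≺right (x≢p , ¬lx))
  ... | no _     | no y≢p   | yes lx | no ¬ly = inj₁ (left≺right lx (y≢p , ¬ly))
  ... | no x≢p   | no _     | no ¬lx | yes ly = inj₂ (left≺right ly (x≢p , ¬lx))
  ... | no x≢p   | no y≢p   | yes lx | yes ly
    with ordered-same-side x≢p y≢p x≢y (left-left⇒¬mid lx ly)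
  ...   | inj₁ pxy = inj₂ (left≺left ly lx pxy)
  ...   | inj₂ pyx = inj₁ (left≺left lx ly pyx)
  ≺-connex {x} {y} x≢y | no x≢p | no y≢p | no ¬lx | no ¬ly
    with ordered-same-side x≢p y≢p x≢y (right-right⇒¬mid (x≢p , ¬lx) (y≢p , ¬ly))
  ...   | inj₁ pxy = inj₁ (right≺right (x≢p , ¬lx) (y≢p , ¬ly) pxy)
  ...   | inj₂ pyx = inj₂ (right≺right (y≢p , ¬ly) (x≢p , ¬lx) pyx)

  ≺-compare : Trichotomous _≡_ _≺_
  ≺-compare x y with x ≟ y
  ... | yes refl = tri≈ (≺-irrefl refl) refl (≺-irrefl refl)
  ... | no x≢y with ≺-connex x≢y
  ...   | inj₁ x≺y = tri< x≺y x≢y (≺-asym x≺y)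
  ...   | inj₂ y≺x = tri> (≺-asym y≺x) x≢y y≺x

  ≺-isStrictTotalOrder : IsStrictTotalOrder _≡_ _≺_
  ≺-isStrictTotalOrder = record
    { isStrictPartialOrder = record
      { isEquivalence = isEquivalence
      ; irrefl        = ≺-irrefl
      ; trans         = ≺-trans
      ; <-resp-≈      = resp₂ _≺_
      }
    ; compare = ≺-compare
    }

  open BtwProperties _≺_ using (Btw-sym; Btw?)
  open BtwProperties _<_ using (Btw-flip)

  first-consistent : ∀ {b c} → R p b c → Btw _≺_ p b c
  first-consistent {b} {c} r = by-sides (R? b p q) (R? c p q)
    where
    b≢p : b ≢ p
    b≢p = ≢-sym (distinct₁₂ r)
    c≢p : c ≢ p
    c≢p = ≢-sym (distinct₁₃ r)
    by-sides : Dec (Left b) → Dec (Left c) → Btw _≺_ p b c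
    by-sides (no ¬lb) (no ¬lc) = inj₁ (pivot≺right (b≢p , ¬lb) , right≺right (b≢p , ¬lb) (c≢p , ¬lc) r)
    by-sides (yes lb) (yes lc) = inj₂ (left≺left lc lb r , left≺pivot lb)
    by-sides (yes lb) (no ¬lc) = contradiction (left-right⇒mid lb (c≢p , ¬lc)) (unique₁ r)
    by-sides (no ¬lb) (yes lc) = contradiction (reverse (left-right⇒mid lc (b≢p , ¬lb))) (unique₁ r)

  mid-consistent : ∀ {a c} → R a p c → Btw _≺_ a p c
  mid-consistent {a} {c} r = by-sides (R? a p q) (R? c p q)
    where
    a≢p : a ≢ p
    a≢p = distinct₁₂ r
    c≢p : c ≢ p
    c≢p = ≢-sym (distinct₂₃ r)
    by-sides : Dec (Left a) → Dec (Left c) → Btw _≺_ a p c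
    by-sides (yes la) (no ¬lc) = inj₁ (left≺pivot la , pivot≺right (c≢p , ¬lc))
    by-sides (no ¬la) (yes lc) = inj₂ (left≺pivot lc , pivot≺right (a≢p , ¬la))
    by-sides (yes la) (yes lc) = contradiction r (left-left⇒¬mid la lc)
    by-sides (no ¬la) (no ¬lc) = contradiction r (right-right⇒¬mid (a≢p , ¬la) (c≢p , ¬lc))

  through-pivot-consistent : ∀ {a b c} → R a b c → Through p a b c → Btw _≺_ a b c
  through-pivot-consistent r (inj₁ refl)        = first-consistent r
  through-pivot-consistent r (inj₂ (inj₁ refl)) = mid-consistent r
  through-pivot-consistent r (inj₂ (inj₂ refl)) = Btw-sym (first-consistent (reverse r))

  OrientedAt : Rel ℕ 0ℓ → (Fin n → ℕ) → Fin n → Set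
  OrientedAt _⊏_ f x = (Left x × f x ⊏ f p) ⊎ (Right x × f p ⊏ f x)

  module Agreement {_⊏_ : Rel ℕ 0ℓ} (sto : IsStrictTotalOrder _≡_ _⊏_) {a b c : Fin n}
                   {f : Fin n → ℕ} (m : Model _⊏_ (Link R p) (fourSet p a b c) f) where
    private
      C : Subset n
      C = fourSet p a b c
      module ⊏ = IsStrictTotalOrder sto
      module B⊏ = StrictTotalOrderBetweenness sto
    open LinkModel sto ∈-fourSet₁ m

    ¬Btw-mid : ∀ {x y} → x ∈ C → y ∈ C → Distinct3 x p y → ¬ R x p y → ¬ Btw _⊏_ (f x) (f p) (f y)
    ¬Btw-mid x∈ y∈ xpy ¬r = ¬r ∘ Btw⇒mid x∈ y∈ xpy

    orientation-spreads : ∀ {x y} → x ∈ C → y ∈ C → y ≢ p → OrientedAt _⊏_ f x → OrientedAt _⊏_ f y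
    orientation-spreads {x} {y} x∈ y∈ y≢p ox with x ≟ y | ox | R? y p q
    ... | yes refl | _ | _ = ox
    ... | no x≢y | inj₁ (lx , x⊏p) | yes ly =
      inj₁ (ly , B⊏.¬Btw-pivot-below (¬Btw-mid x∈ y∈ (left⇒≢p lx , ≢-sym y≢p , x≢y) (left-left⇒¬mid lx ly))
                                     (f-≢ y∈ ∈-fourSet₁ y≢p) x⊏p)
    ... | no x≢y | inj₁ (lx , x⊏p) | no ¬ly =
      inj₂ ((y≢p , ¬ly) , B⊏.Btw-pivot-below (mid⇒Btw x∈ y∈ (left-right⇒mid lx (y≢p , ¬ly))) x⊏p)
    ... | no x≢y | inj₂ (rx , p⊏x) | yes ly =
      inj₁ (ly , B⊏.Btw-pivot-above (mid⇒Btw x∈ y∈ (reverse (left-right⇒mid ly rx))) p⊏x)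
    ... | no x≢y | inj₂ ((x≢p , ¬lx) , p⊏x) | no ¬ly =
      inj₂ ((y≢p , ¬ly) , B⊏.¬Btw-pivot-above
        (¬Btw-mid x∈ y∈ (x≢p , ≢-sym y≢p , x≢y) (right-right⇒¬mid (x≢p , ¬lx) (y≢p , ¬ly)))
        (f-≢ y∈ ∈-fourSet₁ y≢p) p⊏x)

    module _ (oa : OrientedAt _⊏_ f a) where

      oriented : ∀ {x} → x ∈ C → x ≢ p → OrientedAt _⊏_ f x
      oriented x∈ x≢p = orientation-spreads ∈-fourSet₂ x∈ x≢p oa

      ⊏⇒≺ : ∀ {x y} → x ∈ C → y ∈ C → f x ⊏ f y → x ≺ y
      ⊏⇒≺ {x} {y} x∈ y∈ x⊏y with x ≟ p | y ≟ p
      ... | yes refl | yes refl = contradiction x⊏y (⊏.irrefl refl)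
      ... | yes refl | no y≢p with oriented y∈ y≢p
      ...   | inj₁ (_ , y⊏p) = contradiction x⊏y (⊏.asym y⊏p)
      ...   | inj₂ (ry , _)  = pivot≺right ry
      ⊏⇒≺ {x} {y} x∈ y∈ x⊏y | no x≢p | yes refl with oriented x∈ x≢p
      ...   | inj₁ (lx , _)  = left≺pivot lx
      ...   | inj₂ (_ , p⊏x) = contradiction x⊏y (⊏.asym p⊏x)
      ⊏⇒≺ {x} {y} x∈ y∈ x⊏y | no x≢p | no y≢p with oriented x∈ x≢p | oriented y∈ y≢p
      ...   | inj₁ (lx , _)   | inj₁ (ly , y⊏p) =
        left≺left lx ly (Btw⇒first y∈ x∈ (≢-sym y≢p , ≢-sym x≢y , ≢-sym x≢p) (inj₂ (x⊏y , y⊏p)))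
        where
        x≢y : x ≢ y
        x≢y refl = ⊏.irrefl refl x⊏y
      ...   | inj₁ (lx , _)   | inj₂ (ry , _)   = left≺right lx ry
      ...   | inj₂ (_ , p⊏x)  | inj₁ (_ , y⊏p)  = contradiction (⊏.trans p⊏x x⊏y) (⊏.asym y⊏p)
      ...   | inj₂ (rx , p⊏x) | inj₂ (ry , _)   =
        right≺right rx ry (Btw⇒first x∈ y∈ (≢-sym x≢p , x≢y , ≢-sym y≢p) (inj₁ (p⊏x , x⊏y)))
        where
        x≢y : x ≢ y
        x≢y refl = ⊏.irrefl refl x⊏y

      Btw⊏⇒Btw≺ : Btw _⊏_ (f a) (f b) (f c) → Btw _≺_ a b c
      Btw⊏⇒Btw≺ (inj₁ (a⊏b , b⊏c)) = inj₁ (⊏⇒≺ ∈-fourSet₂ ∈-fourSet₃ a⊏b , ⊏⇒≺ ∈-fourSet₃ ∈-fourSet₄ b⊏c)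
      Btw⊏⇒Btw≺ (inj₂ (c⊏b , b⊏a)) = inj₂ (⊏⇒≺ ∈-fourSet₄ ∈-fourSet₃ c⊏b , ⊏⇒≺ ∈-fourSet₃ ∈-fourSet₂ b⊏a)

  avoiding-pivot-consistent : ∀ {a b c} → a ≢ p → ¬ ¬ Realizable R (fourSet p a b c) → R a b c →
                              Btw _≺_ a b c
  avoiding-pivot-consistent {a} {b} {c} a≢p realizable r =
    decidable-stable (Btw? (IsStrictTotalOrder._<?_ ≺-isStrictTotalOrder) a b c) (¬¬-map consistent realizable)
    where
    consistent : Realizable R (fourSet p a b c) → Btw _≺_ a b c
    consistent (f , injective , realizes) = by-orientation (<-cmp (f a) (f p)) (R? a p q)
      where
      link : Model _<_ (Link R p) (fourSet p a b c) f
      link = injective , λ x∈ y∈ z∈ → realizes x∈ y∈ z∈ ∘ proj₁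
      abc : Btw _<_ (f a) (f b) (f c)
      abc = realizes ∈-fourSet₂ ∈-fourSet₃ ∈-fourSet₄ r
      module forward  = Agreement <-isStrictTotalOrder link
      module backward = Agreement (Flip.isStrictTotalOrder <-isStrictTotalOrder) (Model-flip {_⊏_ = _<_} link)
      -- the realization is used as it is or mirrored, whichever matches Left at a
      by-orientation : Tri (f a < f p) (f a ≡ f p) (f p < f a) → Dec (Left a) → Btw _≺_ a b c
      by-orientation (tri≈ _ fa≡fp _) _        = contradiction (injective ∈-fourSet₂ ∈-fourSet₁ fa≡fp) a≢p
      by-orientation (tri< a<p _ _)   (yes la) = forward.Btw⊏⇒Btw≺ (inj₁ (la , a<p)) abc
      by-orientation (tri< a<p _ _)   (no ¬la) = backward.Btw⊏⇒Btw≺ (inj₂ ((a≢p , ¬la) , a<p)) (Btw-flip abc)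
      by-orientation (tri> _ _ p<a)   (yes la) = backward.Btw⊏⇒Btw≺ (inj₁ (la , p<a)) (Btw-flip abc)
      by-orientation (tri> _ _ p<a)   (no ¬la) = forward.Btw⊏⇒Btw≺ (inj₂ ((a≢p , ¬la) , p<a)) abc

-- Maximal packings

module MaximalPacking {n} {R : Triplets n} {U : Subset n} (maximal : ∀ C → ¬ CanAppend R U C)
                      {p : Fin n} (p∉U : p ∉ U) where

  ∣fourSet∩U∣≤2 : ∀ {a b c u} → Distinct₄ p a b c → u ∈ fourSet p a b c → p ≢ u → u ∉ U →
                  ∣ fourSet p a b c ∩ U ∣ ≤ 2
  ∣fourSet∩U∣≤2 {a} {b} {c} d u∈ p≢u u∉U = s≤s⁻¹ (s≤s⁻¹
    (subst (2 + ∣ fourSet p a b c ∩ U ∣ ≤_) (∣fourSet∣≡4 d) (2+∣p∩q∣≤∣p∣ ∈-fourSet₁ u∈ p≢u p∉U u∉U)))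

  link-realizable : ∀ {a b c} → Distinct₄ p a b c → ¬ ¬ Realizable (Link R p) (fourSet p a b c)
  link-realizable {a} {b} {c} d@(p≢a , p≢b , p≢c , _) ¬real =
    maximal _ (appendable (a ∈? U) (b ∈? U) (c ∈? U))
    where
    C : Subset n
    C = fourSet p a b c
    conflict : Conflict R C
    conflict = Conflict-⊇ proj₁ (unrealizable⇒conflict (∣fourSet∣≡4 d) ¬real)
    appendable : Dec (a ∈ U) → Dec (b ∈ U) → Dec (c ∈ U) → CanAppend R U C
    appendable (no a∉U) _        _        = conflict , inj₁ (∣fourSet∩U∣≤2 d ∈-fourSet₂ p≢a a∉U)
    appendable (yes _)  (no b∉U) _        = conflict , inj₁ (∣fourSet∩U∣≤2 d ∈-fourSet₃ p≢b b∉U)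
    appendable (yes _)  (yes _)  (no c∉U) = conflict , inj₁ (∣fourSet∩U∣≤2 d ∈-fourSet₄ p≢c c∉U)
    appendable (yes a∈U) (yes b∈U) (yes c∈U) =
      conflict , inj₂ (p , ∈-fourSet₁ , p∉U , only-p , unrealizable-link⇒seed ∈-fourSet₁ (∣fourSet∣≡4 d) ¬real)
      where
      only-p : ∀ w → w ∈ C → w ∉ U → w ≡ p
      only-p w w∈ w∉U with ∈-fourSet⁻ w∈
      ... | inj₁ w≡p                = w≡p
      ... | inj₂ (inj₁ refl)        = contradiction a∈U w∉U
      ... | inj₂ (inj₂ (inj₁ refl)) = contradiction b∈U w∉U
      ... | inj₂ (inj₂ (inj₂ refl)) = contradiction c∈U w∉U

  realizable : ∀ {a b c} → Distinct₄ p a b c → a ∉ U ⊎ b ∉ U ⊎ c ∉ U → ¬ ¬ Realizable R (fourSet p a b c)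
  realizable {a} {b} {c} d@(p≢a , p≢b , p≢c , _) off-U ¬real =
    maximal _ (unrealizable⇒conflict (∣fourSet∣≡4 d) ¬real , inj₁ (meets-U-in-two off-U))
    where
    meets-U-in-two : a ∉ U ⊎ b ∉ U ⊎ c ∉ U → ∣ fourSet p a b c ∩ U ∣ ≤ 2
    meets-U-in-two (inj₁ a∉U)        = ∣fourSet∩U∣≤2 d ∈-fourSet₂ p≢a a∉U
    meets-U-in-two (inj₂ (inj₁ b∉U)) = ∣fourSet∩U∣≤2 d ∈-fourSet₃ p≢b b∉U
    meets-U-in-two (inj₂ (inj₂ c∉U)) = ∣fourSet∩U∣≤2 d ∈-fourSet₄ p≢c c∉U

module _ {n} {R : Triplets n} (D : Dense R) {U : Subset n} (maximal : ∀ C → ¬ CanAppend R U C) where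
  open Dense D

  off-U-consistent-ordering : Σ (Permutation′ n) λ σ →
    ∀ {a b c} → R a b c → a ∉ U ⊎ b ∉ U ⊎ c ∉ U → Between (pos σ) a b c
  off-U-consistent-ordering with any? (λ x → ¬? (x ∈? U))
  ... | no all-in-U = Permutation.id , λ _ off-U → contradiction off-U [ in-U , [ in-U , in-U ] ]
    where
    in-U : ∀ {x} → ¬ x ∉ U
    in-U {x} x∉U = all-in-U (x , x∉U)
  ... | yes (p , p∉U) with any? (λ x → ¬? (x ≟ p))
  ...   | no only-p =
    Permutation.id , λ r _ → contradiction (trans (is-p _) (sym (is-p _))) (proj₁ (distinct r))
    where
    is-p : ∀ x → x ≡ p
    is-p x = decidable-stable (x ≟ p) (λ x≢p → only-p (x , x≢p))
  ...   | yes (q , q≢p) =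
    σ , λ r off-U → BtwProperties.Btw-map _≺_ {_<_ = _<_} (pos σ) σ-mono (≺-consistent r off-U)
    where
    open MaximalPacking maximal p∉U
    open OrderAroundPivot D p q q≢p link-realizable
    ≺-consistent : ∀ {a b c} → R a b c → a ∉ U ⊎ b ∉ U ⊎ c ∉ U → Btw _≺_ a b c
    ≺-consistent {a} {b} {c} r off-U with (a ≟ p) ⊎-dec (b ≟ p) ⊎-dec (c ≟ p)
    ... | yes through = through-pivot-consistent r through
    ... | no ¬through = avoiding-pivot-consistent (¬through ∘ inj₁) (realizable d off-U) r
      where
      d : Distinct₄ p a b c
      d = ≢-sym (¬through ∘ inj₁) , ≢-sym (¬through ∘ inj₂ ∘ inj₁) , ≢-sym (¬through ∘ inj₂ ∘ inj₂) , distinct r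
    ordering : Σ (Permutation′ n) λ σ → ∀ {x y} → x ≺ y → pos σ x < pos σ y
    ordering = strictTotalOrder⇒permutation ≺-isStrictTotalOrder
    σ : Permutation′ n
    σ = proj₁ ordering
    σ-mono : ∀ {x y} → x ≺ y → pos σ x < pos σ y
    σ-mono = proj₂ ordering

lemma13 : (n : ℕ) (R : Triplets n) → Dense R → (Cs : List (Subset n)) → ConflictPacking R Cs →
    Σ (Permutation′ n) (λ σ → ∀ a b c → R a b c → ¬ Between (pos σ) a b c →
    a ∈ VC Cs × b ∈ VC Cs × c ∈ VC Cs)
lemma13 n R D Cs (_ , maximal) with off-U-consistent-ordering D maximal
... | σ , consistent = σ , λ a b c r inconsistent →
  in-V a (inconsistent ∘ consistent r ∘ inj₁) ,
  in-V b (inconsistent ∘ consistent r ∘ inj₂ ∘ inj₁) ,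
  in-V c (inconsistent ∘ consistent r ∘ inj₂ ∘ inj₂)
  where
  in-V : ∀ x → ¬ x ∉ VC Cs → x ∈ VC Cs
  in-V x = decidable-stable (x ∈? VC Cs)
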